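{- Let $0<c<1$ and $0<d<1$ be irrational numbers, and let $f(n)=[c(n+1)]-[cn]$ and $g(n)=[d(n+1)]-[dn]$ for positive integers $n$. Then for every nonnegative integer $k$ and every real $t\ge0$, $$\sum_{1\le n\le t} f(n)\,g([cn]+k+1) = [d([c([t]+1)]+ k+1)]- [d( k+1)].$$
   Context: $[x]$ denotes the greatest integer not exceeding $x$. -}

module Defs where

open import Data.Nat using (ℕ; zero; suc)
open import Data.Integer using (ℤ; +_; _-_; _*_) renaming (_+_ to _+ℤ_)
open import Data.Rational using (ℚ; _/_; 0ℚ; 1ℚ) renaming (_<_ to _<ℚ_)
open import Data.Product using (∃; _×_)
open import Data.Sum using (_⊎_)
open import Relation.Nullary using (¬_)
open import Relation.Binary.PropositionalEquality using (_≡_)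

-- Real numbers as (two-sided) Dedekind cuts of ℚ:
-- L q  means  q < x,   U q  means  x < q.
record ℝ : Set₁ where
  field
    L U         : ℚ → Set
    L-inhabited : ∃ L
    U-inhabited : ∃ U
    L-lower     : ∀ {p q} → p <ℚ q → L q → L p
    L-open      : ∀ {p} → L p → ∃ λ q → p <ℚ q × L q
    U-upper     : ∀ {p q} → p <ℚ q → U p → U q
    U-open      : ∀ {q} → U q → ∃ λ p → p <ℚ q × U p
    disjoint    : ∀ {q} → ¬ (L q × U q)
    located     : ∀ {p q} → p <ℚ q → L p ⊎ U q
open ℝ public

_<ᵣ_ : ℚ → ℝ → Set
q <ᵣ x = L x q

_ᵣ<_ : ℝ → ℚ → Set
x ᵣ< q = U x q

_≤ᵣ_ : ℚ → ℝ → Set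
q ≤ᵣ x = ¬ (x ᵣ< q)

Irrational : ℝ → Set
Irrational x = ∀ q → ¬ (¬ (q <ᵣ x) × ¬ (x ᵣ< q))

-- FloorMul x m z  :  z = [x · m]   (i.e. z ≤ x·m < z + 1),  m a natural number.
-- For m ≥ 1 this is  z/m ≤ x < (z+1)/m.
FloorMul : ℝ → ℕ → ℤ → Set
FloorMul x zero    z = z ≡ + 0
FloorMul x (suc m) z = ((z / suc m) ≤ᵣ x) × (x ᵣ< ((z +ℤ + 1) / suc m))

Floor : ℝ → ℤ → Set
Floor x z = FloorMul x 1 z

sum1to : ℕ → (ℕ → ℤ) → ℤ
sum1to zero    h = + 0
sum1to (suc N) h = sum1to N h +ℤ h (suc N)

-- Because c < 1, consecutive floors [c(n+1)] and [cn] differ by 0 or 1, so the n-th summand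
-- f(n) g([cn]+k+1) equals G([c(n+1)]+k+1) - G([cn]+k+1) with G(m) = [dm]: when f(n) = 1
-- this is the definition of g, and when f(n) = 0 both sides vanish. The sum telescopes, and
-- [c] = 0.
module Submission where

open import Defs
open import Data.Nat using (ℕ; suc) renaming (_+_ to _+ℕ_)
open import Data.Integer using (ℤ; +_; _-_; _*_)
open import Data.Rational using (0ℚ; 1ℚ)
open import Relation.Binary.PropositionalEquality using (_≡_)

open import Data.Nat as ℕ using (z≤n)
import Data.Nat.Properties as ℕ
import Data.Integer as ℤ
import Data.Integer.Properties as ℤ
open import Data.Integer.Tactic.RingSolver using (solve-∀)
open import Data.Rational as ℚ using (ℚ)
import Data.Rational.Properties as ℚ
import Data.Rational.Unnormalised as ℚᵘ
import Data.Rational.Unnormalised.Properties as ℚᵘ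
open import Data.Product using (_,_)
open import Data.Sum using (_⊎_; inj₁; inj₂)
open import Function using (_∘_)
open import Relation.Binary.Definitions using (tri<; tri≈; tri>)
open import Relation.Binary.PropositionalEquality
  using (refl; sym; trans; cong; cong₂; subst; subst₂; module ≡-Reasoning)
open import Relation.Nullary using (contradiction)

sum1to-telescope : ∀ (a h : ℕ → ℤ) → (∀ n → h n ≡ a (suc n) - a n) →
                   ∀ N → sum1to N h ≡ a (suc N) - a 1
sum1to-telescope a h h≡Δa ℕ.zero    = sym (ℤ.+-inverseʳ (a 1))
sum1to-telescope a h h≡Δa (suc N) = begin
  sum1to N h ℤ.+ h (suc N)                                ≡⟨ cong₂ ℤ._+_ (sum1to-telescope a h h≡Δa N) (h≡Δa (suc N)) ⟩
  (a (suc N) - a 1) ℤ.+ (a (suc (suc N)) - a (suc N))   ≡⟨ telescope (a 1) (a (suc N)) (a (suc (suc N))) ⟩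
  a (suc (suc N)) - a 1                                   ∎
  where
  open ≡-Reasoning
  telescope : ∀ x y z → (y - x) ℤ.+ (z - y) ≡ z - x
  telescope = solve-∀

≤ᵣ-ᵣ<⇒< : ∀ (x : ℝ) {p q : ℚ} → p ≤ᵣ x → x ᵣ< q → p ℚ.< q
≤ᵣ-ᵣ<⇒< x {p} {q} p≤x x<q with ℚ.<-cmp p q
... | tri< p<q _ _ = p<q
... | tri≈ _ refl _ = contradiction x<q p≤x
... | tri> _ _ q<p = contradiction (U-upper x q<p x<q) p≤x

/-cancel-< : ∀ a b m n → (+ a ℚ./ suc m) ℚ.< (+ b ℚ./ suc n) → a ℕ.* suc n ℕ.< b ℕ.* suc m
/-cancel-< a b m n a/m<b/n
  -- `+ a ℚ./ suc m` normalises to `fromℚᵘ (mkℚᵘ (+ a) m)`.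
  with ℚᵘ.<-respʳ-≃ (ℚ.toℚᵘ-fromℚᵘ (ℚᵘ.mkℚᵘ (+ b) n))
         (ℚᵘ.<-respˡ-≃ (ℚ.toℚᵘ-fromℚᵘ (ℚᵘ.mkℚᵘ (+ a) m)) (ℚ.toℚᵘ-mono-< a/m<b/n))
... | ℚᵘ.*<* an<bm
  rewrite sym (ℤ.pos-* a (suc n)) | sym (ℤ.pos-* b (suc m)) = ℤ.drop‿+<+ an<bm

module _ (x : ℝ) where

  -- a/m ≤ x < (b+1)/n, cleared of denominators.
  floorMul-cross : ∀ a b m n → FloorMul x (suc m) (+ a) → FloorMul x (suc n) (+ b) →
                   a ℕ.* suc n ℕ.< suc b ℕ.* suc m
  floorMul-cross a b m n (a≤xm , _) (_ , xn<b+1) =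
    subst (λ b' → a ℕ.* suc n ℕ.< b' ℕ.* suc m) (ℕ.+-comm b 1)
      (/-cancel-< a (b +ℕ 1) m n (≤ᵣ-ᵣ<⇒< x a≤xm xn<b+1))

  ᵣ<1⇒floorMul< : x ᵣ< 1ℚ → ∀ a m → FloorMul x (suc m) (+ a) → a ℕ.< suc m
  ᵣ<1⇒floorMul< x<1 a m (a≤xm , _) =
    subst₂ ℕ._<_ (ℕ.*-identityʳ a) (ℕ.+-identityʳ (suc m)) (/-cancel-< a 1 m 0 (≤ᵣ-ᵣ<⇒< x a≤xm x<1))

module _ {x : ℝ} {F : ℕ → ℕ} (isFloor : ∀ m → FloorMul x m (+ F m)) where

  floor-zero : F 0 ≡ 0
  floor-zero = ℤ.+-injective (isFloor 0)

  floor-mono-suc : ∀ n → F n ℕ.≤ F (suc n)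
  floor-mono-suc ℕ.zero  = subst (ℕ._≤ F 1) (sym floor-zero) z≤n
  floor-mono-suc (suc n) = ℕ.≮⇒≥ λ b<a →
    ℕ.<⇒≱ (floorMul-cross x a b n (suc n) (isFloor (suc n)) (isFloor (suc (suc n)))) (begin
      suc b ℕ.* suc n      ≤⟨ ℕ.*-monoˡ-≤ (suc n) b<a ⟩
      a ℕ.* suc n          ≤⟨ ℕ.*-monoʳ-≤ a (ℕ.n≤1+n (suc n)) ⟩
      a ℕ.* suc (suc n)    ∎)
    where
    open ℕ.≤-Reasoning
    a = F (suc n)
    b = F (suc (suc n))

  module _ (x<1 : x ᵣ< 1ℚ) where

    floor-one : F 1 ≡ 0
    floor-one = ℕ.n<1⇒n≡0 (ᵣ<1⇒floorMul< x x<1 (F 1) 0 (isFloor 1))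

    floor-suc-≤ : ∀ n → F (suc n) ℕ.≤ suc (F n)
    floor-suc-≤ ℕ.zero  = subst (ℕ._≤ suc (F 0)) (sym floor-one) z≤n
    floor-suc-≤ (suc n) = ℕ.≮⇒≥ λ 1+b<a → ℕ.<⇒≱ (ᵣ<1⇒floorMul< x x<1 b n (isFloor (suc n)))
      (ℕ.s≤s⁻¹ (ℕ.+-cancelʳ-< (suc b ℕ.* suc n) (suc n) (suc b) (begin-strict
        suc (suc b) ℕ.* suc n          ≤⟨ ℕ.*-monoˡ-≤ (suc n) 1+b<a ⟩
        a ℕ.* suc n                    <⟨ floorMul-cross x a b (suc n) n (isFloor (suc (suc n))) (isFloor (suc n)) ⟩
        suc b ℕ.* suc (suc n)          ≡⟨ ℕ.*-suc (suc b) (suc n) ⟩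
        suc b ℕ.+ suc b ℕ.* suc n      ∎)))
      where
      open ℕ.≤-Reasoning
      a = F (suc (suc n))
      b = F (suc n)

    floor-step : ∀ n → F (suc n) ≡ F n ⊎ F (suc n) ≡ suc (F n)
    floor-step n with ℕ.m≤n⇒m<n∨m≡n (floor-mono-suc n)
    ... | inj₁ Fn<F1+n = inj₂ (ℕ.≤-antisym (floor-suc-≤ n) Fn<F1+n)
    ... | inj₂ Fn≡F1+n = inj₁ (sym Fn≡F1+n)

+[1+n]-+n≡1 : ∀ n → + suc n - + n ≡ + 1
+[1+n]-+n≡1 n = begin
  + suc n - + n              ≡⟨ cong (_- + n) (ℤ.pos-+ 1 n) ⟩
  (+ 1 ℤ.+ + n) - + n        ≡⟨ cancel (+ 1) (+ n) ⟩
  + 1                        ∎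
  where
  open ≡-Reasoning
  cancel : ∀ i j → (i ℤ.+ j) - j ≡ i
  cancel = solve-∀

step-times-difference : ∀ (h : ℕ → ℤ) {a a'} → a' ≡ a ⊎ a' ≡ suc a →
                        (+ a' - + a) * (h (suc a) - h a) ≡ h a' - h a
step-times-difference h {a} (inj₁ refl) =
  trans (cong (_* (h (suc a) - h a)) (ℤ.+-inverseʳ (+ a))) (sym (ℤ.+-inverseʳ (h a)))
step-times-difference h {a} (inj₂ refl) =
  trans (cong (_* (h (suc a) - h a)) (+[1+n]-+n≡1 a)) (ℤ.*-identityˡ (h (suc a) - h a))

lemma8 : (c d : ℝ) → 0ℚ <ᵣ c → c ᵣ< 1ℚ → Irrational c
    → 0ℚ <ᵣ d → d ᵣ< 1ℚ → Irrational d
    → (F G : ℕ → ℕ)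
    → (∀ m → FloorMul c m (+ F m)) → (∀ m → FloorMul d m (+ G m))
    → (k : ℕ) (t : ℝ) → 0ℚ ≤ᵣ t → (T : ℕ) → Floor t (+ T)
    → sum1to T (λ n → ((+ F (suc n)) - (+ F n))
    * ((+ G (suc (F n +ℕ k +ℕ 1))) - (+ G (F n +ℕ k +ℕ 1))))
    ≡ (+ G (F (suc T) +ℕ k +ℕ 1)) - (+ G (k +ℕ 1))
lemma8 c d _ c<1 _ _ _ _ F G isFloorF _ k _ _ T _ = begin
  sum1to T (λ n → (+ F (suc n) - + F n) * (H (suc (F n)) - H (F n)))
    ≡⟨ sum1to-telescope (H ∘ F) _ (λ n → step-times-difference H (floor-step isFloorF c<1 n)) T ⟩
  H (F (suc T)) - H (F 1)
    ≡⟨ cong (λ m → H (F (suc T)) - H m) (floor-one isFloorF c<1) ⟩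
  H (F (suc T)) - H 0
    ∎
  where
  open ≡-Reasoning
  H : ℕ → ℤ
  H m = + G (m +ℕ k +ℕ 1)
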